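{- Let $T$ be a plane tree with $n\ge1$ edges and let $P=\Phi(T)$ be the 2-Motzkin path of length $n-1$ constructed from $T$ as described in the context. Then (1) the number of old leaves of $T$ equals $1$ plus the number of $U$ steps of $P$; (2) the number of young leaves of $T$ equals the number of $R$ steps of $P$.
   Context: A plane tree is a rooted tree with the children of each vertex linearly ordered left to right; a leaf is a vertex with no children; a leaf is old if it is the leftmost child of its parent, young otherwise. A Dyck path is a lattice path from $(0,0)$ ending on the $x$-axis, never going below it, with steps $U=(1,1)$, $D=(1,-1)$. A 2-Motzkin path is such a path with steps $U$, $D$ and horizontal steps $(1,0)$, each horizontal step colored red ($R$) or blue ($B$); its length is its number of steps. The map $\Phi$ is defined in three stages. (i) Traverse the edges of $T$ in preorder from right to left starting at the root (i.e. depth-first, visiting the children of each vertex from rightmost to leftmost); write $U$ each time an edge is traversed downward and $D$ each time it is traversed upward, giving a Dyck path of length $2n$. (ii) Scanning this Dyck path from left to right, replace each occurrence of $UDU$ by $RU$ (equivalently, every peak $UD$ that is immediately followed by a $U$ is replaced by a single step $R$); this gives a path with steps $U,D,R$. (iii) In this path, mark every $U$ immediately followed by $D$, every $D$ immediately followed by another $D$, and the final $D$ of the path. Then change every unmarked $U$ whose matching $D$ is marked into a blue step $B$ (the matching $D$ of a $U$ step is the first $D$ step to its right that returns to the height at which that $U$ starts; $R$ steps do not change height). Finally delete all marked steps. The result $\Phi(T)$ is a 2-Motzkin path of length $n-1$, and $\Phi$ is a bijection from plane trees with $n$ edges to 2-Motzkin paths of length $n-1$. -}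

module Defs where

open import Data.Nat using (ℕ; zero; suc; _+_)
open import Data.Bool using (Bool; true; false; if_then_else_)
open import Data.List using (List; []; _∷_; _++_; reverse; concatMap; [_])
open import Data.Maybe using (Maybe; just; nothing)

-- Plane trees: a vertex with an ordered (left-to-right) list of children.
data Tree : Set where
  node : List Tree → Tree

mutual
  edges : Tree → ℕ
  edges (node cs) = edgesL cs

  edgesL : List Tree → ℕ
  edgesL []       = 0
  edgesL (c ∷ cs) = suc (edges c) + edgesL cs

isLeaf : Tree → Bool
isLeaf (node []) = true
isLeaf (node (_ ∷ _)) = false

b2n : Bool → ℕ
b2n true  = 1
b2n false = 0

-- old leaves: leaves that are the leftmost (first) child of their parent
mutual
  oldLeaves : Tree → ℕ
  oldLeaves (node [])       = 0
  oldLeaves (node (c ∷ cs)) = b2n (isLeaf c) + oldLeaves c + oldLeavesL cs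

  -- old leaves inside the given subtrees (not counting the subtree roots)
  oldLeavesL : List Tree → ℕ
  oldLeavesL []       = 0
  oldLeavesL (c ∷ cs) = oldLeaves c + oldLeavesL cs

-- young leaves: leaves that are children but not the leftmost child
mutual
  youngLeaves : Tree → ℕ
  youngLeaves (node [])       = 0
  youngLeaves (node (c ∷ cs)) = youngLeaves c + youngRest cs

  youngRest : List Tree → ℕ
  youngRest []       = 0
  youngRest (c ∷ cs) = b2n (isLeaf c) + youngLeaves c + youngRest cs

-- Steps of paths: U, D, and horizontal red R / blue B
data Step : Set where
  U D R B : Step

-- Stage (i): preorder, visiting children right to left
mutual
  dyck : Tree → List Step
  dyck (node cs) = dyckL cs

  dyckL : List Tree → List Step
  dyckL []       = []
  dyckL (c ∷ cs) = dyckL cs ++ (U ∷ dyck c ++ [ D ])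

stage2 : List Step → List Step
stage2 (U ∷ D ∷ rest@(U ∷ _)) = R ∷ stage2 rest
stage2 (x ∷ xs) = x ∷ stage2 xs
stage2 [] = []

headM : List Step → Maybe Step
headM []      = nothing
headM (x ∷ _) = just x

-- whether a step with the given successor (nothing = last step) is marked
markAt : Step → Maybe Step → Bool
markAt U (just D) = true
markAt D (just D) = true
markAt D nothing  = true
markAt _ _        = false

marks : List Step → List Bool
marks []       = []
marks (x ∷ xs) = markAt x (headM xs) ∷ marks xs

-- matchOff d xs : offset in xs of the first D returning below the current
-- level, where d is the current height above the starting height of the U.
matchOff : ℕ → List Step → Maybe ℕ
matchOff d [] = nothing
matchOff zero (D ∷ xs) = just zero
matchOff (suc d) (D ∷ xs) = Data.Maybe.map suc (matchOff d xs)
matchOff d (U ∷ xs) = Data.Maybe.map suc (matchOff (suc d) xs)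
matchOff d (R ∷ xs) = Data.Maybe.map suc (matchOff d xs)
matchOff d (B ∷ xs) = Data.Maybe.map suc (matchOff d xs)

nthB : List Bool → ℕ → Bool
nthB []       _       = false
nthB (b ∷ _)  zero    = b
nthB (_ ∷ bs) (suc k) = nthB bs k

-- convert an (unmarked) step: a U whose matching D is marked becomes B.
-- xs, ms: the steps following it and their marks.
convert : Step → List Step → List Bool → Step
convert U xs ms with matchOff zero xs
... | just k  = if nthB ms k then B else U
... | nothing = U
convert x _ _ = x

deleteMarked : List Step → List Bool → List Step
deleteMarked (x ∷ xs) (m ∷ ms) =
  if m then deleteMarked xs ms else (convert x xs ms ∷ deleteMarked xs ms)
deleteMarked _ _ = []

stage3 : List Step → List Step
stage3 xs = deleteMarked xs (marks xs)

Φ : Tree → List Step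
Φ t = stage3 (stage2 (dyck t))

countU : List Step → ℕ
countU []       = 0
countU (U ∷ xs) = suc (countU xs)
countU (_ ∷ xs) = countU xs

countR : List Step → ℕ
countR []       = 0
countR (R ∷ xs) = suc (countR xs)
countR (_ ∷ xs) = countR xs

module Submission where

open import Defs
open import Data.Nat using (ℕ; suc; zero; _+_; _≤_)
open import Data.Nat.Properties using (+-comm; +-assoc; +-identityʳ; +-commutativeSemigroup)
open import Algebra.Properties.CommutativeSemigroup +-commutativeSemigroup using (x∙yz≈yx∙z)
open import Data.Bool using (Bool; true; false; not; _∧_)
open import Data.Bool.Properties using (not-involutive; ∧-identityʳ; ∧-zeroʳ)
open import Data.List using (List; []; _∷_; _++_; length)
open import Data.List.Properties using (++-assoc; ++-identityʳ; length-++)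
open import Data.Maybe using (just; nothing)
import Data.Maybe as Maybe
open import Data.Maybe.Properties using (map-id; map-∘; map-cong)
open import Data.Product using (_×_; _,_)
open import Function using (_∘_)
open import Relation.Binary.PropositionalEquality using (_≡_; refl; sym; trans; cong; cong₂)
open Relation.Binary.PropositionalEquality.≡-Reasoning

-- Old leaves correspond to the root together with the internal vertices that
-- are not leftmost children: descend along leftmost children to reach the old
-- leaf.  Since the traversal is right to left, the block U…D of a subtree in
-- the Dyck word is followed by a U exactly when the subtree is not a leftmost
-- child.  Hence stage (ii) turns precisely the young leaves into R steps, which
-- stage (iii) keeps; and the opening U of an internal subtree survives stage
-- (iii) precisely when its matching D is unmarked, i.e. followed by a U, every
-- other U being marked or turned blue.

mutual
  youngInternal : Tree → ℕ
  youngInternal (node [])       = 0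
  youngInternal (node (c ∷ cs)) = youngInternal c + youngInternalRest cs

  youngInternalRest : List Tree → ℕ
  youngInternalRest []       = 0
  youngInternalRest (c ∷ cs) = b2n (not (isLeaf c)) + youngInternal c + youngInternalRest cs

mutual
  oldLeaves-internal : ∀ c cs →
    oldLeaves (node (c ∷ cs)) ≡ suc (youngInternal (node (c ∷ cs)))
  oldLeaves-internal (node [])       cs = cong suc (oldLeavesL≡youngInternalRest cs)
  oldLeaves-internal (node (e ∷ es)) cs =
    cong₂ _+_ (oldLeaves-internal e es) (oldLeavesL≡youngInternalRest cs)

  oldLeavesL≡youngInternalRest : ∀ cs → oldLeavesL cs ≡ youngInternalRest cs
  oldLeavesL≡youngInternalRest []                   = refl
  oldLeavesL≡youngInternalRest (node [] ∷ cs)       = oldLeavesL≡youngInternalRest cs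
  oldLeavesL≡youngInternalRest (node (e ∷ es) ∷ cs) =
    cong₂ _+_ (oldLeaves-internal e es) (oldLeavesL≡youngInternalRest cs)

-- The image under stage (ii) of the Dyck word of a forest (resp. of the block
-- U dyck c D of a subtree c), given whether the word following it starts with
-- U: a leaf followed by U is a peak UD·U, which becomes R.
mutual
  forestPath : List Tree → Bool → List Step
  forestPath []       followedByU = []
  forestPath (c ∷ cs) followedByU = forestPath cs true ++ subtreePath c followedByU

  subtreePath : Tree → Bool → List Step
  subtreePath (node [])       true  = R ∷ []
  subtreePath (node [])       false = U ∷ D ∷ []
  subtreePath (node (c ∷ cs)) _     = U ∷ forestPath (c ∷ cs) false ++ D ∷ []

startsWithU : List Step → Bool
startsWithU (U ∷ _) = true
startsWithU _       = false

headM-dyckL-++ : ∀ c cs ws → headM (dyckL (c ∷ cs) ++ ws) ≡ just U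
headM-dyckL-++ c []        ws = refl
headM-dyckL-++ c (c′ ∷ cs) ws
  rewrite ++-assoc (dyckL (c′ ∷ cs)) (U ∷ dyck c ++ D ∷ []) ws = headM-dyckL-++ c′ cs _

stage2-U : ∀ xs → headM xs ≡ just U → stage2 (U ∷ xs) ≡ U ∷ stage2 xs
stage2-U (U ∷ xs) refl = refl

stage2-leaf : ∀ ys →
  stage2 (U ∷ D ∷ ys) ≡ subtreePath (node []) (startsWithU ys) ++ stage2 ys
stage2-leaf []      = refl
stage2-leaf (U ∷ _) = refl
stage2-leaf (D ∷ _) = refl
stage2-leaf (R ∷ _) = refl
stage2-leaf (B ∷ _) = refl

mutual
  stage2-dyckL-++ : ∀ cs ys →
    stage2 (dyckL cs ++ ys) ≡ forestPath cs (startsWithU ys) ++ stage2 ys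
  stage2-dyckL-++ []       ys = refl
  stage2-dyckL-++ (c ∷ cs) ys = begin
    stage2 ((dyckL cs ++ U ∷ dyck c ++ D ∷ []) ++ ys)
      ≡⟨ cong stage2 (++-assoc (dyckL cs) (U ∷ dyck c ++ D ∷ []) ys) ⟩
    stage2 (dyckL cs ++ U ∷ (dyck c ++ D ∷ []) ++ ys)
      ≡⟨ cong (λ zs → stage2 (dyckL cs ++ U ∷ zs)) (++-assoc (dyck c) (D ∷ []) ys) ⟩
    stage2 (dyckL cs ++ U ∷ dyck c ++ D ∷ ys)
      ≡⟨ stage2-dyckL-++ cs _ ⟩
    forestPath cs true ++ stage2 (U ∷ dyck c ++ D ∷ ys)
      ≡⟨ cong (forestPath cs true ++_) (stage2-block c ys) ⟩
    forestPath cs true ++ subtreePath c (startsWithU ys) ++ stage2 ys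
      ≡⟨ ++-assoc (forestPath cs true) _ _ ⟨
    (forestPath cs true ++ subtreePath c (startsWithU ys)) ++ stage2 ys ∎

  stage2-block : ∀ c ys →
    stage2 (U ∷ dyck c ++ D ∷ ys) ≡ subtreePath c (startsWithU ys) ++ stage2 ys
  stage2-block (node [])       ys = stage2-leaf ys
  stage2-block (node (c ∷ cs)) ys = begin
    stage2 (U ∷ dyckL (c ∷ cs) ++ D ∷ ys)
      ≡⟨ stage2-U _ (headM-dyckL-++ c cs (D ∷ ys)) ⟩
    U ∷ stage2 (dyckL (c ∷ cs) ++ D ∷ ys)
      ≡⟨ cong (U ∷_) (stage2-dyckL-++ (c ∷ cs) (D ∷ ys)) ⟩
    U ∷ forestPath (c ∷ cs) false ++ D ∷ stage2 ys
      ≡⟨ cong (U ∷_) (++-assoc (forestPath (c ∷ cs) false) (D ∷ []) (stage2 ys)) ⟨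
    (U ∷ forestPath (c ∷ cs) false ++ D ∷ []) ++ stage2 ys ∎

stage2-dyckL : ∀ cs → stage2 (dyckL cs) ≡ forestPath cs false
stage2-dyckL cs = begin
  stage2 (dyckL cs)         ≡⟨ cong stage2 (++-identityʳ (dyckL cs)) ⟨
  stage2 (dyckL cs ++ [])   ≡⟨ stage2-dyckL-++ cs [] ⟩
  forestPath cs false ++ [] ≡⟨ ++-identityʳ _ ⟩
  forestPath cs false       ∎

countR-++ : ∀ xs ys → countR (xs ++ ys) ≡ countR xs + countR ys
countR-++ []       ys = refl
countR-++ (U ∷ xs) ys = countR-++ xs ys
countR-++ (D ∷ xs) ys = countR-++ xs ys
countR-++ (R ∷ xs) ys = cong suc (countR-++ xs ys)
countR-++ (B ∷ xs) ys = countR-++ xs ys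

mutual
  countR-forestPath-true : ∀ cs → countR (forestPath cs true) ≡ youngRest cs
  countR-forestPath-true []       = refl
  countR-forestPath-true (c ∷ cs) = begin
    countR (forestPath cs true ++ subtreePath c true)
      ≡⟨ countR-++ (forestPath cs true) _ ⟩
    countR (forestPath cs true) + countR (subtreePath c true)
      ≡⟨ cong₂ _+_ (countR-forestPath-true cs) (countR-subtreePath c true) ⟩
    youngRest cs + (b2n (isLeaf c) + youngLeaves c)
      ≡⟨ +-comm (youngRest cs) _ ⟩
    b2n (isLeaf c) + youngLeaves c + youngRest cs ∎

  countR-forestPath-false : ∀ cs → countR (forestPath cs false) ≡ youngLeaves (node cs)
  countR-forestPath-false []       = refl
  countR-forestPath-false (c ∷ cs) = begin
    countR (forestPath cs true ++ subtreePath c false)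
      ≡⟨ countR-++ (forestPath cs true) _ ⟩
    countR (forestPath cs true) + countR (subtreePath c false)
      ≡⟨ cong₂ _+_ (countR-forestPath-true cs) (countR-subtreePath c false) ⟩
    youngRest cs + youngLeaves c
      ≡⟨ +-comm (youngRest cs) _ ⟩
    youngLeaves c + youngRest cs ∎

  countR-subtreePath : ∀ c b → countR (subtreePath c b) ≡ b2n (b ∧ isLeaf c) + youngLeaves c
  countR-subtreePath (node [])       true  = refl
  countR-subtreePath (node [])       false = refl
  countR-subtreePath (node (c ∷ cs)) b     = begin
    countR (U ∷ forestPath (c ∷ cs) false ++ D ∷ [])
      ≡⟨ countR-++ (forestPath (c ∷ cs) false) (D ∷ []) ⟩
    countR (forestPath (c ∷ cs) false) + 0
      ≡⟨ +-identityʳ _ ⟩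
    countR (forestPath (c ∷ cs) false)
      ≡⟨ countR-forestPath-false (c ∷ cs) ⟩
    youngLeaves (node (c ∷ cs))
      ≡⟨ cong (λ x → b2n x + youngLeaves (node (c ∷ cs))) (∧-zeroʳ b) ⟨
    b2n (b ∧ false) + youngLeaves (node (c ∷ cs)) ∎

countR-convert-U : ∀ xs ms r → countR (convert U xs ms ∷ r) ≡ countR r
countR-convert-U xs ms r with matchOff zero xs
... | nothing = refl
... | just k with nthB ms k
...   | true  = refl
...   | false = refl

countR-stage3 : ∀ xs → countR (stage3 xs) ≡ countR xs
countR-stage3 []       = refl
countR-stage3 (U ∷ xs) with markAt U (headM xs)
... | true  = countR-stage3 xs
... | false = trans (countR-convert-U xs (marks xs) _) (countR-stage3 xs)
countR-stage3 (D ∷ xs) with markAt D (headM xs)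
... | true  = countR-stage3 xs
... | false = countR-stage3 xs
countR-stage3 (R ∷ xs) = cong suc (countR-stage3 xs)
countR-stage3 (B ∷ xs) = countR-stage3 xs

matchOff-U : ∀ d xs → matchOff d (U ∷ xs) ≡ Maybe.map suc (matchOff (suc d) xs)
matchOff-U zero    xs = refl
matchOff-U (suc d) xs = refl

matchOff-R : ∀ d xs → matchOff d (R ∷ xs) ≡ Maybe.map suc (matchOff d xs)
matchOff-R zero    xs = refl
matchOff-R (suc d) xs = refl

map-+-map-+ : ∀ a b m → Maybe.map (a +_) (Maybe.map (b +_) m) ≡ Maybe.map (a + b +_) m
map-+-map-+ a b m = trans (sym (map-∘ m)) (map-cong (λ j → sym (+-assoc a b j)) m)

Balanced : List Step → Set
Balanced w = ∀ d ys → matchOff d (w ++ ys) ≡ Maybe.map (length w +_) (matchOff d ys)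

balanced-[] : Balanced []
balanced-[] d ys = sym (map-id (matchOff d ys))

balanced-R : Balanced (R ∷ [])
balanced-R = matchOff-R

balanced-++ : ∀ v w → Balanced v → Balanced w → Balanced (v ++ w)
balanced-++ v w bv bw d ys = begin
  matchOff d ((v ++ w) ++ ys)
    ≡⟨ cong (matchOff d) (++-assoc v w ys) ⟩
  matchOff d (v ++ w ++ ys)
    ≡⟨ bv d (w ++ ys) ⟩
  Maybe.map (length v +_) (matchOff d (w ++ ys))
    ≡⟨ cong (Maybe.map (length v +_)) (bw d ys) ⟩
  Maybe.map (length v +_) (Maybe.map (length w +_) (matchOff d ys))
    ≡⟨ map-+-map-+ (length v) (length w) (matchOff d ys) ⟩
  Maybe.map (length v + length w +_) (matchOff d ys)
    ≡⟨ cong (λ n → Maybe.map (n +_) (matchOff d ys)) (length-++ v) ⟨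
  Maybe.map (length (v ++ w) +_) (matchOff d ys) ∎

balanced-wrap : ∀ w → Balanced w → Balanced (U ∷ w ++ D ∷ [])
balanced-wrap w bw d ys = begin
  matchOff d (U ∷ (w ++ D ∷ []) ++ ys)
    ≡⟨ matchOff-U d _ ⟩
  Maybe.map suc (matchOff (suc d) ((w ++ D ∷ []) ++ ys))
    ≡⟨ cong (Maybe.map suc ∘ matchOff (suc d)) (++-assoc w (D ∷ []) ys) ⟩
  Maybe.map suc (matchOff (suc d) (w ++ D ∷ ys))
    ≡⟨ cong (Maybe.map suc) (bw (suc d) (D ∷ ys)) ⟩
  Maybe.map (1 +_) (Maybe.map (length w +_) (Maybe.map (1 +_) (matchOff d ys)))
    ≡⟨ cong (Maybe.map (1 +_)) (map-+-map-+ (length w) 1 (matchOff d ys)) ⟩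
  Maybe.map (1 +_) (Maybe.map (length w + 1 +_) (matchOff d ys))
    ≡⟨ map-+-map-+ 1 (length w + 1) (matchOff d ys) ⟩
  Maybe.map (suc (length w + 1) +_) (matchOff d ys)
    ≡⟨ cong (λ n → Maybe.map (suc n +_) (matchOff d ys)) (length-++ w) ⟨
  Maybe.map (length (U ∷ w ++ D ∷ []) +_) (matchOff d ys) ∎

mutual
  balanced-forestPath : ∀ cs b → Balanced (forestPath cs b)
  balanced-forestPath []       b = balanced-[]
  balanced-forestPath (c ∷ cs) b = balanced-++ (forestPath cs true) (subtreePath c b)
    (balanced-forestPath cs true) (balanced-subtreePath c b)

  balanced-subtreePath : ∀ c b → Balanced (subtreePath c b)
  balanced-subtreePath (node [])       true  = balanced-R
  balanced-subtreePath (node [])       false = balanced-wrap [] balanced-[]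
  balanced-subtreePath (node (c ∷ cs)) _     =
    balanced-wrap (forestPath (c ∷ cs) false) (balanced-forestPath (c ∷ cs) false)

nthB-marks-++ : ∀ w zs k → nthB (marks (w ++ zs)) (length w + k) ≡ nthB (marks zs) k
nthB-marks-++ []      zs k = refl
nthB-marks-++ (_ ∷ w) zs k = nthB-marks-++ w zs k

countU-stage3-D : ∀ xs → countU (stage3 (D ∷ xs)) ≡ countU (stage3 xs)
countU-stage3-D xs with markAt D (headM xs)
... | true  = refl
... | false = refl

countU-stage3-U : ∀ xs k → markAt U (headM xs) ≡ false → matchOff zero xs ≡ just k →
  countU (stage3 (U ∷ xs)) ≡ b2n (not (nthB (marks xs) k)) + countU (stage3 xs)
countU-stage3-U xs k unmarked matched rewrite unmarked | matched with nthB (marks xs) k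
... | true  = refl
... | false = refl

markAt-head-subtreePath : ∀ x c b ws → markAt x (headM (subtreePath c b ++ ws)) ≡ false
markAt-head-subtreePath U (node [])      true  _ = refl
markAt-head-subtreePath U (node [])      false _ = refl
markAt-head-subtreePath U (node (_ ∷ _)) _     _ = refl
markAt-head-subtreePath D (node [])      true  _ = refl
markAt-head-subtreePath D (node [])      false _ = refl
markAt-head-subtreePath D (node (_ ∷ _)) _     _ = refl
markAt-head-subtreePath R _              _     _ = refl
markAt-head-subtreePath B _              _     _ = refl

markAt-head-forestPath : ∀ x c cs b ws →
  markAt x (headM (forestPath (c ∷ cs) b ++ ws)) ≡ false
markAt-head-forestPath x c []        b ws = markAt-head-subtreePath x c b ws
markAt-head-forestPath x c (c′ ∷ cs) b ws
  rewrite ++-assoc (forestPath (c′ ∷ cs) true) (subtreePath c b) ws =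
  markAt-head-forestPath x c′ cs true _

mutual
  countU-forestPath-∷ : ∀ c cs b ys → markAt D (headM ys) ≡ not b →
    countU (stage3 (forestPath (c ∷ cs) b ++ ys))
      ≡ b2n (b ∧ not (isLeaf c)) + youngInternal c + youngInternalRest cs + countU (stage3 ys)
  countU-forestPath-∷ c cs b ys closes = begin
    countU (stage3 ((forestPath cs true ++ subtreePath c b) ++ ys))
      ≡⟨ cong (countU ∘ stage3) (++-assoc (forestPath cs true) (subtreePath c b) ys) ⟩
    countU (stage3 (forestPath cs true ++ subtreePath c b ++ ys))
      ≡⟨ countU-forestPath-true cs _ (markAt-head-subtreePath D c b ys) ⟩
    youngInternalRest cs + countU (stage3 (subtreePath c b ++ ys))
      ≡⟨ cong (youngInternalRest cs +_) (countU-subtreePath c b ys closes) ⟩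
    youngInternalRest cs + (b2n (b ∧ not (isLeaf c)) + youngInternal c + countU (stage3 ys))
      ≡⟨ x∙yz≈yx∙z (youngInternalRest cs) (b2n (b ∧ not (isLeaf c)) + youngInternal c) _ ⟩
    b2n (b ∧ not (isLeaf c)) + youngInternal c + youngInternalRest cs + countU (stage3 ys) ∎

  countU-forestPath-true : ∀ cs ys → markAt D (headM ys) ≡ false →
    countU (stage3 (forestPath cs true ++ ys)) ≡ youngInternalRest cs + countU (stage3 ys)
  countU-forestPath-true []       ys _      = refl
  countU-forestPath-true (c ∷ cs) ys closes = countU-forestPath-∷ c cs true ys closes

  countU-forestPath-false : ∀ cs ys → markAt D (headM ys) ≡ true →
    countU (stage3 (forestPath cs false ++ ys))
      ≡ youngInternal (node cs) + countU (stage3 ys)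
  countU-forestPath-false []       ys _      = refl
  countU-forestPath-false (c ∷ cs) ys closes = countU-forestPath-∷ c cs false ys closes

  countU-subtreePath : ∀ c b ys → markAt D (headM ys) ≡ not b →
    countU (stage3 (subtreePath c b ++ ys))
      ≡ b2n (b ∧ not (isLeaf c)) + youngInternal c + countU (stage3 ys)
  countU-subtreePath (node [])       true  ys _ = refl
  countU-subtreePath (node [])       false ys _ = countU-stage3-D ys
  countU-subtreePath (node (c ∷ cs)) b     ys closes = begin
    countU (stage3 (U ∷ (F ++ D ∷ []) ++ ys))
      ≡⟨ cong (λ zs → countU (stage3 (U ∷ zs))) (++-assoc F (D ∷ []) ys) ⟩
    countU (stage3 (U ∷ F ++ D ∷ ys))
      ≡⟨ countU-stage3-U (F ++ D ∷ ys) (length F + 0)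
           (markAt-head-forestPath U c cs false (D ∷ ys))
           (balanced-forestPath (c ∷ cs) false zero (D ∷ ys)) ⟩
    b2n (not (nthB (marks (F ++ D ∷ ys)) (length F + 0))) + countU (stage3 (F ++ D ∷ ys))
      ≡⟨ cong₂ _+_ (cong (b2n ∘ not) (trans (nthB-marks-++ F (D ∷ ys) 0) closes))
                   (countU-forestPath-false (c ∷ cs) (D ∷ ys) refl) ⟩
    b2n (not (not b)) + (youngInternal (node (c ∷ cs)) + countU (stage3 (D ∷ ys)))
      ≡⟨ cong₂ (λ x n → b2n x + (youngInternal (node (c ∷ cs)) + n))
               (trans (not-involutive b) (sym (∧-identityʳ b))) (countU-stage3-D ys) ⟩
    b2n (b ∧ true) + (youngInternal (node (c ∷ cs)) + countU (stage3 ys))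
      ≡⟨ +-assoc (b2n (b ∧ true)) _ _ ⟨
    b2n (b ∧ true) + youngInternal (node (c ∷ cs)) + countU (stage3 ys) ∎
    where
    F = forestPath (c ∷ cs) false

countU-Φ : ∀ t → countU (Φ t) ≡ youngInternal t
countU-Φ (node cs) = begin
  countU (stage3 (stage2 (dyckL cs)))
    ≡⟨ cong (countU ∘ stage3) (stage2-dyckL cs) ⟩
  countU (stage3 (forestPath cs false))
    ≡⟨ cong (countU ∘ stage3) (++-identityʳ (forestPath cs false)) ⟨
  countU (stage3 (forestPath cs false ++ []))
    ≡⟨ countU-forestPath-false cs [] refl ⟩
  youngInternal (node cs) + 0
    ≡⟨ +-identityʳ _ ⟩
  youngInternal (node cs) ∎

countR-Φ : ∀ t → countR (Φ t) ≡ youngLeaves t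
countR-Φ (node cs) = begin
  countR (stage3 (stage2 (dyckL cs))) ≡⟨ countR-stage3 (stage2 (dyckL cs)) ⟩
  countR (stage2 (dyckL cs))          ≡⟨ cong countR (stage2-dyckL cs) ⟩
  countR (forestPath cs false)        ≡⟨ countR-forestPath-false cs ⟩
  youngLeaves (node cs)               ∎

mainTheorem4 : (T : Tree) → 1 ≤ edges T →
    (oldLeaves T ≡ suc (countU (Φ T))) × (youngLeaves T ≡ countR (Φ T))
mainTheorem4 (node [])       ()
mainTheorem4 (node (c ∷ cs)) _ =
  trans (oldLeaves-internal c cs) (cong suc (sym (countU-Φ (node (c ∷ cs))))) ,
  sym (countR-Φ (node (c ∷ cs)))
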